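{- Let $d\ge 2$, let $p,q$ be integers with $q\ge 2$, $p\not\equiv0\pmod q$ and $\gcd(p,q)=1$, and let $p^*$ be the multiplicative inverse of $p$ in $\mathbb{Z}/q\mathbb{Z}$. Let $t=0.\overline{a_0a_1\dots a_{q-1}}\in\mathbb{T}$ (base-$d$ digits $a_i\in\{0,\dots,d-1\}$, indices in $\mathbb{Z}/q\mathbb{Z}$), and let $\mathcal{O}$ be the $\sigma_d$-orbit of $t$. Then $\mathcal{O}$ is $\sigma_d$-rotational with rotation number $p/q$ and $t$ is the least element of $\mathcal{O}$ if and only if $$a_0\leq a_{p^*}\leq a_{2p^*}\leq \dots \leq a_{ -(p+1)p^*} < a_{ -pp^*}\leq\dots\leq a_{(q-1)p^*},$$ i.e. the sequence $k\mapsto a_{kp^*}$, $k=0,1,\dots,q-1$ (subscripts reduced mod $q$), is nondecreasing with a strict increase from the term $k=q-p-1$ to the term $k=q-p$ (here $p$ is represented in $\{1,\dots,q-1\}$).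
   Context: $\mathbb{T}=\mathbb{R}/\mathbb{Z}$, totally ordered by choosing representatives in $[0,1)$. $\sigma_d(t)=dt$ on $\mathbb{T}$; the orbit of $t$ is $\{\sigma_d^k(t):k\ge0\}$. A finite set $A=\{t_0<\dots<t_{q-1}\}$, indices in $\mathbb{Z}/q\mathbb{Z}$, is $\sigma_d$-rotational with rotation number $p/q$ if $0\ne p\in\mathbb{Z}/q\mathbb{Z}$ and $\sigma_d(t_i)=t_{i+p}$ for all $i$. -}

module Defs where

open import Data.Nat as ℕ using (ℕ; zero; suc; NonZero)
open import Data.Nat.DivMod using (_mod_)
open import Data.Fin using (Fin; toℕ)
import Data.Fin as F
open import Data.Empty using (⊥)
open import Data.Integer as ℤ using (ℤ; +_)
open import Data.Rational as ℚ using (ℚ; floor; _/_)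
open import Data.Product using (Σ; ∃; _×_)
open import Relation.Binary.PropositionalEquality using (_≡_)

-- Points of 𝕋 = ℝ/ℤ that we need are rational; a point of 𝕋 is represented
-- by its unique representative in [0,1).  frac x = x - ⌊x⌋ ∈ [0,1).
frac : ℚ → ℚ
frac x = x ℚ.- (floor x / 1)

σ : ℕ → ℚ → ℚ
σ d x = frac ((+ d / 1) ℚ.* x)

σ^ : ℕ → ℕ → ℚ → ℚ
σ^ d zero    x = x
σ^ d (suc k) x = σ d (σ^ d k x)

InOrbit : ℕ → ℚ → ℚ → Set
InOrbit d t x = ∃ λ k → x ≡ σ^ d k t

-- division of an integer by a natural number (returns 0 for denominator 0;
-- only used with a nonzero denominator)
div : ℤ → ℕ → ℚ
div n zero    = ℚ.0ℚ
div n (suc m) = n / suc m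

-- Σ_{i<q} a_i d^(q-1-i), the integer whose base-d digits are a_0 … a_{q-1}
digitsValue : (d q : ℕ) → (Fin q → ℕ) → ℕ
digitsValue d q a = go q (λ i → a i)
  where
  go : (n : ℕ) → (Fin n → ℕ) → ℕ
  go zero    b = 0
  go (suc n) b = b F.zero ℕ.* d ℕ.^ n ℕ.+ go n (λ i → b (F.suc i))

-- The point t = 0.(a_0 a_1 … a_{q-1}) repeating, in base d, as a point of 𝕋:
-- the value of the repeating expansion is N/(d^q - 1), reduced mod 1.
periodicPoint : (d q : ℕ) → (Fin q → ℕ) → ℚ
periodicPoint d q a = frac (div (+ digitsValue d q a) (d ℕ.^ q ℕ.∸ 1))

-- A finite set A ⊆ 𝕋 given by a membership predicate is σ_d-rotational with
-- rotation number p/q: A = {t_0 < … < t_{q-1}} (listed by a strictly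
-- increasing enumeration onto A), p ≢ 0 mod q, and σ_d(t_i) = t_{i+p}.
Rotational : (d : ℕ) → (A : ℚ → Set) → (p q : ℕ) → .{{_ : NonZero q}} → Set
Rotational d A p q =
  (p ℕ.% q ≡ 0 → ⊥) ×
  Σ (Fin q → ℚ) λ e →
    ((i j : Fin q) → toℕ i ℕ.< toℕ j → e i ℚ.< e j) ×
    ((i : Fin q) → A (e i)) ×
    ((x : ℚ) → A x → ∃ λ i → x ≡ e i) ×
    ((i : Fin q) → σ d (e i) ≡ e ((toℕ i ℕ.+ p) mod q))

{-# OPTIONS --safe #-}
module Submission where

-- Let y_j be the integer whose base-d digits are a_{jp*}, a_{jp*+1}, …, a_{jp*+q-1}.  Then
-- σ^{jp*}(t) = y_j / (d^q - 1), except when every digit is d - 1 and the orbit is {0}.  An orbit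
-- that is rotational with rotation number p/q and has least element t is listed in increasing order
-- as t_j = σ^{jp*}(t), so the left-hand side says that y_0 < y_1 < … < y_{q-1}.  Writing
-- b_j = a_{jp*}, shifting the expansion by one digit gives d y_j = b_j (d^q - 1) + y_{j+p}, so
-- y_i and y_j compare like the pairs (b_i, y_{i+p}) and (b_j, y_{j+p}) lexicographically.  Hence
-- increasing y forces b to be nondecreasing, strictly so from q - p - 1 to q - p, where j + p wraps
-- around from q - 1 to 0.  Conversely, if b_i = b_j with i < j, then i and j lie on the same side
-- of that ascent, so i + p < j + p (mod q) still; since p is invertible mod q, iterating
-- i ↦ i + p reaches q - p - 1 after finitely many steps, and there the digits differ.

open import Defs
open import Data.Nat as ℕ using (ℕ; zero; suc; NonZero; _+_; _*_; _∸_; _^_; _/_; _%_; _<_; _≤_; s≤s; z≤n)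
import Data.Nat.Properties as ℕ
open import Data.Nat.DivMod as ℕ using (_mod_)
import Data.Nat.Solver as ℕ-Solver
open import Data.Nat.GCD using (gcd)
open import Data.Fin as Fin using (Fin; toℕ)
import Data.Fin.Properties as Fin
open import Data.Integer as ℤ using (+_; -[1+_])
import Data.Integer.Properties as ℤ
import Data.Integer.Solver as ℤ-Solver
open import Data.Rational as ℚ using (ℚ; mkℚ; floor; toℚᵘ)
import Data.Rational.Properties as ℚ
open import Data.Rational.Unnormalised as ℚᵘ using (mkℚᵘ; *≡*; *<*)
import Data.Rational.Unnormalised.Properties as ℚᵘ
open import Data.Empty using (⊥; ⊥-elim)
open import Data.Product using (∃; _×_; _,_; proj₁; proj₂)
open import Data.Sum using (_⊎_; inj₁; inj₂)
open import Function.Bundles using (_⇔_; mk⇔)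
import Function.Properties.Equivalence as Equivalence
open import Level using (0ℓ)
open import Relation.Nullary using (yes; no)
open import Relation.Binary.Bundles using (Setoid)
open import Relation.Binary.PropositionalEquality
import Relation.Binary.Reasoning.Setoid

m*r≡n*o⇒m/o≡n/r : ∀ m n o r .{{_ : NonZero o}} .{{_ : NonZero r}} → m * r ≡ n * o → m / o ≡ n / r
m*r≡n*o⇒m/o≡n/r m n o r eq = begin
  m / o            ≡⟨ ℕ.m*n/o*n≡m/o m r o ⟨
  m * r / (o * r)  ≡⟨ ℕ./-congˡ eq ⟩
  n * o / (o * r)  ≡⟨ ℕ./-congʳ (ℕ.*-comm o r) ⟩
  n * o / (r * o)  ≡⟨ ℕ.m*n/o*n≡m/o n o r ⟩
  n / r            ∎
  where
  open ≡-Reasoning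
  instance
    _ : NonZero (o * r)
    _ = ℕ.m*n≢0 o r
    _ : NonZero (r * o)
    _ = ℕ.m*n≢0 r o

div≡/ : ∀ i M .{{_ : NonZero M}} → div i M ≡ i ℚ./ M
div≡/ i (suc m) = refl

toℚᵘ-/ : ∀ n m → toℚᵘ (+ n ℚ./ suc m) ℚᵘ.≃ mkℚᵘ (+ n) m
toℚᵘ-/ n m = ℚ.toℚᵘ-fromℚᵘ (mkℚᵘ (+ n) m)

floor-/ : ∀ n M .{{_ : NonZero M}} → floor (+ n ℚ./ M) ≡ + (n / M)
floor-/ n (suc m) = floor-≃ (+ n ℚ./ suc m) (toℚᵘ-/ n m)
  where
  -- floor reads off the reduced numerator and denominator, so abstract over the normal form of n / M.
  floor-≃ : ∀ x → toℚᵘ x ℚᵘ.≃ mkℚᵘ (+ n) m → floor x ≡ + (n / suc m)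
  floor-≃ (mkℚ (+ u) v _) (*≡* eq) = trans (ℤ.*-identityˡ _) (cong +_ (m*r≡n*o⇒m/o≡n/r u n (suc v) (suc m)
    (ℤ.+-injective (trans (ℤ.pos-* u (suc m)) (trans eq (sym (ℤ.pos-* n (suc v))))))))
  floor-≃ (mkℚ -[1+ u ] v _) (*≡* eq) with trans eq (sym (ℤ.pos-* n (suc v)))
  ... | ()

/-split : ∀ n M .{{_ : NonZero M}} → + n ℚ./ M ≡ + (n % M) ℚ./ M ℚ.+ + (n / M) ℚ./ 1
/-split n M@(suc m) = ℚ.toℚᵘ-injective (begin-equality
  toℚᵘ (+ n ℚ./ M)                                 ≃⟨ toℚᵘ-/ n m ⟩
  mkℚᵘ (+ n) m                                     ≃⟨ *≡* cross ⟩
  mkℚᵘ (+ r) m ℚᵘ.+ mkℚᵘ (+ k) 0                   ≃⟨ ℚᵘ.+-cong (toℚᵘ-/ r m) (toℚᵘ-/ k 0) ⟨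
  toℚᵘ (+ r ℚ./ M) ℚᵘ.+ toℚᵘ (+ k ℚ./ 1)           ≃⟨ ℚ.toℚᵘ-homo-+ (+ r ℚ./ M) (+ k ℚ./ 1) ⟨
  toℚᵘ (+ r ℚ./ M ℚ.+ + k ℚ./ 1)                   ∎)
  where
  open ℚᵘ.≤-Reasoning
  open ℤ-Solver.+-*-Solver
  r k : ℕ
  r = n % M
  k = n / M
  n≡r+kM : + n ≡ + r ℤ.+ + k ℤ.* + M
  n≡r+kM = trans (cong +_ (ℕ.m≡m%n+[m/n]*n n M)) (trans (ℤ.pos-+ r (k * M)) (cong (ℤ._+_ (+ r)) (ℤ.pos-* k M)))
  cross : + n ℤ.* + (M * 1) ≡ (+ r ℤ.* + 1 ℤ.+ + k ℤ.* + M) ℤ.* + M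
  cross = trans (cong₂ ℤ._*_ n≡r+kM (cong +_ (ℕ.*-identityʳ M)))
    (solve 3 (λ R K D → (R :+ K :* D) :* D := (R :* con (+ 1) :+ K :* D) :* D) refl (+ r) (+ k) (+ M))

frac-/ : ∀ n M .{{_ : NonZero M}} → frac (+ n ℚ./ M) ≡ + (n % M) ℚ./ M
frac-/ n M = begin
  + n ℚ./ M ℚ.- floor (+ n ℚ./ M) ℚ./ 1   ≡⟨ cong₂ (λ x j → x ℚ.- j ℚ./ 1) (/-split n M) (floor-/ n M) ⟩
  (x ℚ.+ y) ℚ.- y                         ≡⟨ ℚ.+-assoc x y (ℚ.- y) ⟩
  x ℚ.+ (y ℚ.- y)                         ≡⟨ cong (x ℚ.+_) (ℚ.+-inverseʳ y) ⟩
  x ℚ.+ ℚ.0ℚ                              ≡⟨ ℚ.+-identityʳ x ⟩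
  x                                       ∎
  where
  open ≡-Reasoning
  x y : ℚ
  x = + (n % M) ℚ./ M
  y = + (n / M) ℚ./ 1

*-/ : ∀ d n M .{{_ : NonZero M}} → (+ d ℚ./ 1) ℚ.* (+ n ℚ./ M) ≡ + (d * n) ℚ./ M
*-/ d n M@(suc m) = ℚ.toℚᵘ-injective (begin-equality
  toℚᵘ ((+ d ℚ./ 1) ℚ.* (+ n ℚ./ M))       ≃⟨ ℚ.toℚᵘ-homo-* (+ d ℚ./ 1) (+ n ℚ./ M) ⟩
  toℚᵘ (+ d ℚ./ 1) ℚᵘ.* toℚᵘ (+ n ℚ./ M)     ≃⟨ ℚᵘ.*-cong (toℚᵘ-/ d 0) (toℚᵘ-/ n m) ⟩
  mkℚᵘ (+ d) 0 ℚᵘ.* mkℚᵘ (+ n) m             ≃⟨ *≡* cross ⟩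
  mkℚᵘ (+ (d * n)) m                         ≃⟨ toℚᵘ-/ (d * n) m ⟨
  toℚᵘ (+ (d * n) ℚ./ M)                     ∎)
  where
  open ℚᵘ.≤-Reasoning
  cross : + d ℤ.* + n ℤ.* + M ≡ + (d * n) ℤ.* + (1 * M)
  cross = cong₂ ℤ._*_ (sym (ℤ.pos-* d n)) (cong +_ (sym (ℕ.*-identityˡ M)))

σ-/ : ∀ d n M .{{_ : NonZero M}} → σ d (+ n ℚ./ M) ≡ + (d * n % M) ℚ./ M
σ-/ d n M = trans (cong frac (*-/ d n M)) (frac-/ (d * n) M)

/-monoˡ-< : ∀ M .{{_ : NonZero M}} {r s} → r ℕ.< s → + r ℚ./ M ℚ.< + s ℚ./ M
/-monoˡ-< M@(suc m) {r} {s} r<s = ℚ.toℚᵘ-cancel-<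
  (ℚᵘ.<-respˡ-≃ (ℚᵘ.≃-sym (toℚᵘ-/ r m)) (ℚᵘ.<-respʳ-≃ (ℚᵘ.≃-sym (toℚᵘ-/ s m))
    (*<* (subst₂ ℤ._<_ (ℤ.pos-* r M) (ℤ.pos-* s M) (ℤ.+<+ (ℕ.*-monoˡ-< M r<s))))))

/-cancelˡ-< : ∀ M .{{_ : NonZero M}} {r s} → + r ℚ./ M ℚ.< + s ℚ./ M → r ℕ.< s
/-cancelˡ-< M@(suc m) {r} {s} r/M<s/M = ℕ.*-cancelʳ-< M r s (ℤ.drop‿+<+
  (subst₂ ℤ._<_ (sym (ℤ.pos-* r M)) (sym (ℤ.pos-* s M))
    (ℚᵘ.drop-*<* (ℚᵘ.<-respˡ-≃ (toℚᵘ-/ r m) (ℚᵘ.<-respʳ-≃ (toℚᵘ-/ s m) (ℚ.toℚᵘ-mono-< r/M<s/M))))))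

-- A record rather than an equation between remainders, so that m and n can be inferred from the type.
infix 4 _≡_[mod_]
record _≡_[mod_] (m n q : ℕ) .{{_ : NonZero q}} : Set where
  constructor mk-mod
  field %≡% : m % q ≡ n % q
open _≡_[mod_] public

module Modular (q : ℕ) .{{_ : NonZero q}} where

  mod-setoid : Setoid 0ℓ 0ℓ
  mod-setoid = record
    { _≈_           = _≡_[mod q ]
    ; isEquivalence = record
      { refl  = mk-mod refl
      ; sym   = λ m≡n → mk-mod (sym (%≡% m≡n))
      ; trans = λ m≡n n≡o → mk-mod (trans (%≡% m≡n) (%≡% n≡o))
      }
    }

  open Setoid mod-setoid public using ()
    renaming (refl to mod-refl; sym to mod-sym; trans to mod-trans; reflexive to mod-reflexive)
  module mod-Reasoning = Relation.Binary.Reasoning.Setoid mod-setoid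

  %-mod : ∀ m → m % q ≡ m [mod q ]
  %-mod m = mk-mod (ℕ.m%n%n≡m%n m q)

  +-mod : ∀ {m m′ n n′} → m ≡ m′ [mod q ] → n ≡ n′ [mod q ] → m + n ≡ m′ + n′ [mod q ]
  +-mod {m} {m′} {n} {n′} (mk-mod m≡m′) (mk-mod n≡n′) = mk-mod (begin
    (m + n) % q                ≡⟨ ℕ.%-distribˡ-+ m n q ⟩
    (m % q + n % q) % q        ≡⟨ cong₂ (λ x y → (x + y) % q) m≡m′ n≡n′ ⟩
    (m′ % q + n′ % q) % q      ≡⟨ ℕ.%-distribˡ-+ m′ n′ q ⟨
    (m′ + n′) % q              ∎)
    where open ≡-Reasoning

  *-mod : ∀ {m m′ n n′} → m ≡ m′ [mod q ] → n ≡ n′ [mod q ] → m * n ≡ m′ * n′ [mod q ]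
  *-mod {m} {m′} {n} {n′} (mk-mod m≡m′) (mk-mod n≡n′) = mk-mod (begin
    (m * n) % q                ≡⟨ ℕ.%-distribˡ-* m n q ⟩
    (m % q * (n % q)) % q      ≡⟨ cong₂ (λ x y → (x * y) % q) m≡m′ n≡n′ ⟩
    (m′ % q * (n′ % q)) % q    ≡⟨ ℕ.%-distribˡ-* m′ n′ q ⟨
    (m′ * n′) % q              ∎)
    where open ≡-Reasoning

  +q-mod : ∀ m → m + q ≡ m [mod q ]
  +q-mod m = mk-mod (ℕ.[m+n]%n≡m%n m q)

  mod⇒≡ : ∀ {m n} → m < q → n < q → m ≡ n [mod q ] → m ≡ n
  mod⇒≡ m<q n<q (mk-mod m≡n) = trans (sym (ℕ.m<n⇒m%n≡m m<q)) (trans m≡n (ℕ.m<n⇒m%n≡m n<q))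

  %-wrap : ∀ {m} → q ≤ m → m < q + q → m % q ≡ m ∸ q
  %-wrap {m} q≤m m<q+q = trans (sym (ℕ.m≤n⇒[n∸m]%m≡n%m q≤m))
    (ℕ.m<n⇒m%n≡m (subst (m ∸ q <_) (ℕ.m+n∸n≡m q q) (ℕ.∸-monoˡ-< m<q+q q≤m)))

  toℕ-mod : ∀ m → toℕ (m mod q) ≡ m [mod q ]
  toℕ-mod m = mod-trans (mod-reflexive (Fin.toℕ-fromℕ< (ℕ.m%n<n m q))) (%-mod m)

  mod-cong : ∀ {m n} → m ≡ n [mod q ] → m mod q ≡ n mod q
  mod-cong {m} {n} (mk-mod m%q≡n%q) = Fin.fromℕ<-cong (m % q) (n % q) m%q≡n%q (ℕ.m%n<n m q) (ℕ.m%n<n n q)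

  %≡1⇒≡1[mod] : ∀ {m} → m % q ≡ 1 → m ≡ 1 [mod q ]
  %≡1⇒≡1[mod] {m} m%q≡1 = mk-mod (trans m%q≡1 (sym 1%q≡1))
    where
    1%q≡1 : 1 % q ≡ 1
    1%q≡1 = trans (cong (_% q) (sym m%q≡1)) (trans (ℕ.m%n%n≡m%n m q) m%q≡1)

  module Inverse (p p⁻¹ : ℕ) (p*p⁻¹≡1 : p * p⁻¹ ≡ 1 [mod q ]) where

    m*p*p⁻¹≡m : ∀ m → m * p * p⁻¹ ≡ m [mod q ]
    m*p*p⁻¹≡m m = begin
      m * p * p⁻¹    ≡⟨ ℕ.*-assoc m p p⁻¹ ⟩
      m * (p * p⁻¹)  ≈⟨ *-mod (mod-refl {m}) p*p⁻¹≡1 ⟩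
      m * 1          ≡⟨ ℕ.*-identityʳ m ⟩
      m              ∎
      where open mod-Reasoning

    m*p⁻¹*p≡m : ∀ m → m * p⁻¹ * p ≡ m [mod q ]
    m*p⁻¹*p≡m m = begin
      m * p⁻¹ * p    ≡⟨ trans (ℕ.*-assoc m p⁻¹ p) (cong (m *_) (ℕ.*-comm p⁻¹ p)) ⟩
      m * (p * p⁻¹)  ≡⟨ ℕ.*-assoc m p p⁻¹ ⟨
      m * p * p⁻¹    ≈⟨ m*p*p⁻¹≡m m ⟩
      m              ∎
      where open mod-Reasoning

    1+i*p⁻¹≡[i+p]*p⁻¹ : ∀ i → suc (i * p⁻¹) ≡ (i + p) * p⁻¹ [mod q ]
    1+i*p⁻¹≡[i+p]*p⁻¹ i = begin
      suc (i * p⁻¹)      ≡⟨ ℕ.+-comm 1 (i * p⁻¹) ⟩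
      i * p⁻¹ + 1        ≈⟨ +-mod (mod-refl {i * p⁻¹}) p*p⁻¹≡1 ⟨
      i * p⁻¹ + p * p⁻¹  ≡⟨ ℕ.*-distribʳ-+ p⁻¹ i p ⟨
      (i + p) * p⁻¹      ∎
      where open mod-Reasoning

    reach : ∀ {i} j → i < q → ∃ λ m → i + m * p ≡ j [mod q ]
    reach {i} j i<q = (j + (q ∸ i)) * p⁻¹ , (begin
      i + (j + (q ∸ i)) * p⁻¹ * p   ≈⟨ +-mod (mod-refl {i}) (m*p⁻¹*p≡m (j + (q ∸ i))) ⟩
      i + (j + (q ∸ i))             ≡⟨ solve 3 (λ i j r → i :+ (j :+ r) := j :+ (i :+ r)) refl i j (q ∸ i) ⟩
      j + (i + (q ∸ i))             ≡⟨ cong (_+_ j) (ℕ.m+[n∸m]≡n (ℕ.<⇒≤ i<q)) ⟩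
      j + q                         ≈⟨ +q-mod j ⟩
      j                             ∎)
      where
      open mod-Reasoning
      open ℕ-Solver.+-*-Solver

module _ (d : ℕ) where

  digitsValue-cong : ∀ m {b b′ : Fin m → ℕ} → (∀ i → b i ≡ b′ i) → digitsValue d m b ≡ digitsValue d m b′
  digitsValue-cong zero    b≗b′ = refl
  digitsValue-cong (suc m) b≗b′ = cong₂ (λ x y → x * d ^ m + y) (b≗b′ Fin.zero) (digitsValue-cong m (λ i → b≗b′ (Fin.suc i)))

  digitsValue-snoc : ∀ m (b : Fin (suc m) → ℕ) →
    digitsValue d (suc m) b ≡ d * digitsValue d m (λ i → b (Fin.inject₁ i)) + b (Fin.fromℕ m)
  digitsValue-snoc zero    b = solve 2 (λ x d → x :* con 1 :+ con 0 := d :* con 0 :+ x) refl (b Fin.zero) d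
    where open ℕ-Solver.+-*-Solver
  digitsValue-snoc (suc m) b = begin
    b₀ * d ^ suc m + digitsValue d (suc m) b′
      ≡⟨ cong (_+_ (b₀ * d ^ suc m)) (digitsValue-snoc m b′) ⟩
    b₀ * (d * d ^ m) + (d * middle + b (Fin.fromℕ (suc m)))
      ≡⟨ solve 5 (λ x d e X y → x :* (d :* e) :+ (d :* X :+ y) := d :* (x :* e :+ X) :+ y) refl b₀ d (d ^ m) middle (b (Fin.fromℕ (suc m))) ⟩
    d * (b₀ * d ^ m + middle) + b (Fin.fromℕ (suc m))
      ∎
    where
    open ≡-Reasoning
    open ℕ-Solver.+-*-Solver
    b₀ : ℕ
    b₀ = b Fin.zero
    b′ : Fin (suc m) → ℕ
    b′ i = b (Fin.suc i)
    middle : ℕ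
    middle = digitsValue d m (λ i → b′ (Fin.inject₁ i))

  digitsValue-< : ∀ m (b : Fin m → ℕ) → (∀ i → b i < d) → digitsValue d m b < d ^ m
  digitsValue-< zero    b b<d = s≤s z≤n
  digitsValue-< (suc m) b b<d = begin-strict
    b₀ * d ^ m + digitsValue d m b′  <⟨ ℕ.+-monoʳ-< (b₀ * d ^ m) (digitsValue-< m b′ (λ i → b<d (Fin.suc i))) ⟩
    b₀ * d ^ m + d ^ m               ≡⟨ ℕ.+-comm (b₀ * d ^ m) (d ^ m) ⟩
    suc b₀ * d ^ m                   ≤⟨ ℕ.*-monoˡ-≤ (d ^ m) (b<d Fin.zero) ⟩
    d * d ^ m                        ∎
    where
    open ℕ.≤-Reasoning
    b₀ : ℕ
    b₀ = b Fin.zero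
    b′ : Fin m → ℕ
    b′ i = b (Fin.suc i)

module RotatedDigits (d n : ℕ) (a : Fin (suc n) → ℕ) where

  private
    q : ℕ
    q = suc n

  open Modular q

  digit : ℕ → ℕ
  digit k = a (k mod q)

  rotation : ℕ → ℕ
  rotation k = digitsValue d q (λ i → digit (toℕ i + k))

  rotation-periodic : ∀ {k k′} → k ≡ k′ [mod q ] → rotation k ≡ rotation k′
  rotation-periodic k≡k′ = digitsValue-cong d q (λ i → cong a (mod-cong (+-mod (mod-refl {toℕ i}) k≡k′)))

  rotation-zero : digitsValue d q a ≡ rotation 0
  rotation-zero = digitsValue-cong d q (λ i → cong a (sym (Fin.toℕ-injective
    (mod⇒≡ (Fin.toℕ<n _) (Fin.toℕ<n i) (mod-trans (toℕ-mod (toℕ i + 0)) (mod-reflexive (ℕ.+-identityʳ (toℕ i))))))))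

  rotation-< : (∀ i → a i < d) → ∀ k → rotation k < d ^ q
  rotation-< a<d k = digitsValue-< d q (λ i → digit (toℕ i + k)) (λ i → a<d ((toℕ i + k) mod q))

  last+1+k≡k : ∀ k → toℕ (Fin.fromℕ n) + suc k ≡ k [mod q ]
  last+1+k≡k k = begin
    toℕ (Fin.fromℕ n) + suc k   ≡⟨ cong (_+ suc k) (Fin.toℕ-fromℕ n) ⟩
    n + suc k                   ≡⟨ trans (ℕ.+-suc n k) (ℕ.+-comm q k) ⟩
    k + q                       ≈⟨ +q-mod k ⟩
    k                           ∎
    where open mod-Reasoning

  rotation-step : ∀ k → d * rotation k + digit k ≡ digit k * d ^ q + rotation (suc k)
  rotation-step k = begin
    d * (digit k * d ^ n + tail) + digit k
      ≡⟨ solve 4 (λ d c e X → d :* (c :* e :+ X) :+ c := c :* (d :* e) :+ (d :* X :+ c)) refl d (digit k) (d ^ n) tail ⟩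
    digit k * d ^ q + (d * tail + digit k)
      ≡⟨ cong₂ (λ x y → digit k * d ^ q + (d * x + y)) tail≡ last≡ ⟩
    digit k * d ^ q + (d * init + digit (toℕ (Fin.fromℕ n) + suc k))
      ≡⟨ cong (_+_ (digit k * d ^ q)) (digitsValue-snoc d n (λ i → digit (toℕ i + suc k))) ⟨
    digit k * d ^ q + rotation (suc k)
      ∎
    where
    open ≡-Reasoning
    open ℕ-Solver.+-*-Solver
    tail init : ℕ
    tail = digitsValue d n (λ i → digit (suc (toℕ i) + k))
    init = digitsValue d n (λ i → digit (toℕ (Fin.inject₁ i) + suc k))
    tail≡ : tail ≡ init
    tail≡ = digitsValue-cong d n (λ i → cong digit (sym (trans (cong (_+ suc k) (Fin.toℕ-inject₁ i)) (ℕ.+-suc (toℕ i) k))))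
    last≡ : digit k ≡ digit (toℕ (Fin.fromℕ n) + suc k)
    last≡ = cong a (mod-cong (mod-sym (last+1+k≡k k)))

IncreasingBelow : {A : Set} → (A → A → Set) → ℕ → (ℕ → A) → Set
IncreasingBelow _≺_ q f = ∀ {i j} → i < j → j < q → f i ≺ f j

-- If σ permutes the sorted orbit t₀ < … < t_{q-1} by tᵢ ↦ t_{i+p} and t = t₀, then σᵏ t = t_{kp},
-- so that t_j = σ^{j p⁻¹} t.
ranked : (d p⁻¹ : ℕ) → ℚ → ℕ → ℚ
ranked d p⁻¹ t j = σ^ d (j * p⁻¹) t

module RotationalOrbit (d n p p⁻¹ : ℕ) (t : ℚ)
  (1≤p : 1 ≤ p) (p<q : p < suc n) (p*p⁻¹≡1 : p * p⁻¹ ≡ 1 [mod suc n ])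
  (orbit-periodic : ∀ k k′ → k ≡ k′ [mod suc n ] → σ^ d k t ≡ σ^ d k′ t) where

  private
    q : ℕ
    q = suc n

  open Modular q
  open Inverse p p⁻¹ p*p⁻¹≡1

  Minimal : Set
  Minimal = (x : ℚ) → InOrbit d t x → t ℚ.≤ x

  rotational⇒increasing : Rotational d (InOrbit d t) p q × Minimal → IncreasingBelow ℚ._<_ q (ranked d p⁻¹ t)
  rotational⇒increasing ((_ , e , e-< , e-∈ , e-onto , σ∘e) , t-minimal) {i} {j} i<j j<q =
    subst₂ ℚ._<_ (sym (orbit≡e (i * p⁻¹))) (sym (orbit≡e (j * p⁻¹)))
      (e-< _ _ (subst₂ _<_ (sym (rank (ℕ.<-trans i<j j<q))) (sym (rank j<q)) i<j))
    where
    e₀≤e : ∀ i → e Fin.zero ℚ.≤ e i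
    e₀≤e Fin.zero    = ℚ.≤-refl
    e₀≤e (Fin.suc i) = ℚ.<⇒≤ (e-< Fin.zero (Fin.suc i) (s≤s z≤n))

    t≡e₀ : t ≡ e Fin.zero
    t≡e₀ with e-onto t (0 , refl)
    ... | i , t≡eᵢ = ℚ.≤-antisym (t-minimal _ (e-∈ Fin.zero)) (subst (e Fin.zero ℚ.≤_) (sym t≡eᵢ) (e₀≤e i))

    orbit≡e : ∀ k → σ^ d k t ≡ e ((k * p) mod q)
    orbit≡e zero    = trans t≡e₀ (cong e (mod-cong (%-mod 0)))
    orbit≡e (suc k) = trans (cong (σ d) (orbit≡e k)) (trans (σ∘e _) (cong e (mod-cong (begin
      toℕ ((k * p) mod q) + p   ≈⟨ +-mod (toℕ-mod (k * p)) (mod-refl {p}) ⟩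
      k * p + p                 ≡⟨ ℕ.+-comm (k * p) p ⟩
      suc k * p                 ∎))))
      where open mod-Reasoning

    rank : ∀ {j} → j < q → toℕ ((j * p⁻¹ * p) mod q) ≡ j
    rank {j} j<q = mod⇒≡ (Fin.toℕ<n _) j<q (mod-trans (toℕ-mod (j * p⁻¹ * p)) (m*p⁻¹*p≡m j))

  increasing⇒rotational : IncreasingBelow ℚ._<_ q (ranked d p⁻¹ t) → Rotational d (InOrbit d t) p q × Minimal
  increasing⇒rotational ranked-< = (p≢0 , e , e-< , e-∈ , e-onto , σ∘e) , t-minimal
    where
    p≢0 : p % q ≡ 0 → ⊥
    p≢0 p%q≡0 = ℕ.<⇒≢ 1≤p (sym (trans (sym (ℕ.m<n⇒m%n≡m p<q)) p%q≡0))

    e : Fin q → ℚ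
    e i = ranked d p⁻¹ t (toℕ i)

    e-< : (i j : Fin q) → toℕ i < toℕ j → e i ℚ.< e j
    e-< i j i<j = ranked-< i<j (Fin.toℕ<n j)

    e-∈ : (i : Fin q) → InOrbit d t (e i)
    e-∈ i = toℕ i * p⁻¹ , refl

    e-onto : (x : ℚ) → InOrbit d t x → ∃ λ i → x ≡ e i
    e-onto x (k , refl) = (k * p) mod q , orbit-periodic k _ (begin
      k                              ≈⟨ m*p*p⁻¹≡m k ⟨
      k * p * p⁻¹                    ≈⟨ *-mod (toℕ-mod (k * p)) (mod-refl {p⁻¹}) ⟨
      toℕ ((k * p) mod q) * p⁻¹      ∎)
      where open mod-Reasoning

    σ∘e : (i : Fin q) → σ d (e i) ≡ e ((toℕ i + p) mod q)
    σ∘e i = orbit-periodic (suc (toℕ i * p⁻¹)) _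
      (mod-trans (1+i*p⁻¹≡[i+p]*p⁻¹ (toℕ i)) (*-mod (mod-sym (toℕ-mod (toℕ i + p))) (mod-refl {p⁻¹})))

    t-minimal : Minimal
    t-minimal x x∈ with e-onto x x∈
    ... | Fin.zero  , refl = ℚ.≤-refl
    ... | Fin.suc i , refl = ℚ.<⇒≤ (ranked-< (s≤s z≤n) (Fin.toℕ<n (Fin.suc i)))

  rotational⇔increasing : (Rotational d (InOrbit d t) p q × Minimal) ⇔ IncreasingBelow ℚ._<_ q (ranked d p⁻¹ t)
  rotational⇔increasing = mk⇔ rotational⇒increasing increasing⇒rotational

module DigitRecurrence (d M p : ℕ) (y b : ℕ → ℕ)
  (y<M : ∀ i → y i < M) (y-step : ∀ i → d * y i ≡ b i * M + y (i + p)) where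

  <-by-leading-digit : ∀ {i j} → b i < b j → y i < y j
  <-by-leading-digit {i} {j} bᵢ<bⱼ = ℕ.*-cancelˡ-< d (y i) (y j) (begin-strict
    d * y i                ≡⟨ y-step i ⟩
    b i * M + y (i + p)    <⟨ ℕ.+-monoʳ-< (b i * M) (y<M (i + p)) ⟩
    b i * M + M            ≡⟨ ℕ.+-comm (b i * M) M ⟩
    suc (b i) * M          ≤⟨ ℕ.*-monoˡ-≤ M bᵢ<bⱼ ⟩
    b j * M                ≤⟨ ℕ.m≤m+n (b j * M) (y (j + p)) ⟩
    b j * M + y (j + p)    ≡⟨ y-step j ⟨
    d * y j                ∎)
    where open ℕ.≤-Reasoning

  <-by-tail : ∀ {i j} → b i ≡ b j → y (i + p) < y (j + p) → y i < y j
  <-by-tail {i} {j} bᵢ≡bⱼ tail-< = ℕ.*-cancelˡ-< d (y i) (y j) (begin-strict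
    d * y i                ≡⟨ y-step i ⟩
    b i * M + y (i + p)    <⟨ ℕ.+-monoʳ-< (b i * M) tail-< ⟩
    b i * M + y (j + p)    ≡⟨ cong (λ x → x * M + y (j + p)) bᵢ≡bⱼ ⟩
    b j * M + y (j + p)    ≡⟨ y-step j ⟨
    d * y j                ∎)
    where open ℕ.≤-Reasoning

  leading-digit-mono : ∀ {i j} → y i < y j → b i ≤ b j
  leading-digit-mono yᵢ<yⱼ = ℕ.≮⇒≥ (λ bⱼ<bᵢ → ℕ.<-asym yᵢ<yⱼ (<-by-leading-digit bⱼ<bᵢ))

  tail-mono : .{{_ : NonZero d}} → ∀ {i j} → b i ≡ b j → y i < y j → y (i + p) < y (j + p)
  tail-mono {i} {j} bᵢ≡bⱼ yᵢ<yⱼ = ℕ.+-cancelˡ-< (b i * M) (y (i + p)) (y (j + p)) (begin-strict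
    b i * M + y (i + p)    ≡⟨ y-step i ⟨
    d * y i                <⟨ ℕ.*-monoʳ-< d yᵢ<yⱼ ⟩
    d * y j                ≡⟨ y-step j ⟩
    b j * M + y (j + p)    ≡⟨ cong (λ x → x * M + y (j + p)) bᵢ≡bⱼ ⟨
    b i * M + y (j + p)    ∎)
    where open ℕ.≤-Reasoning

MonotoneBelow : ℕ → (ℕ → ℕ) → Set
MonotoneBelow q b = ∀ k → k + 1 < q → b k ≤ b (k + 1)

module Lexicographic (d M q p p⁻¹ c : ℕ) .{{_ : NonZero d}} .{{_ : NonZero q}}
  (p*p⁻¹≡1 : p * p⁻¹ ≡ 1 [mod q ]) (1≤p : 1 ≤ p) (c+1+p≡q : suc c + p ≡ q)
  (y b : ℕ → ℕ) (y<M : ∀ i → y i < M) (y-periodic : ∀ {i j} → i ≡ j [mod q ] → y i ≡ y j)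
  (y-step : ∀ i → d * y i ≡ b i * M + y (i + p)) where

  open Modular q
  open DigitRecurrence d M p y b y<M y-step
  open Inverse p p⁻¹ p*p⁻¹≡1

  c+p<q : c + p < q
  c+p<q = subst (c + p <_) c+1+p≡q (ℕ.n<1+n (c + p))

  c+1<q : suc c < q
  c+1<q = ℕ.≤-<-trans (ℕ.≤-trans (ℕ.≤-reflexive (ℕ.+-comm 1 c)) (ℕ.+-monoʳ-≤ c 1≤p)) c+p<q

  p<q : p < q
  p<q = ℕ.<-≤-trans (ℕ.m<n+m p (s≤s z≤n)) (ℕ.≤-reflexive c+1+p≡q)

  monotone-suc : MonotoneBelow q b → ∀ k → suc k < q → b k ≤ b (suc k)
  monotone-suc b-mono k k+1<q = subst (λ x → b k ≤ b x) (ℕ.+-comm k 1) (b-mono k (subst (_< q) (ℕ.+-comm 1 k) k+1<q))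

  increasing⇒digits : IncreasingBelow _<_ q y → MonotoneBelow q b × b c < b (suc c)
  increasing⇒digits y-< = b-mono , jump
    where
    b-mono : MonotoneBelow q b
    b-mono k k+1<q = leading-digit-mono (y-< (ℕ.m<m+n k (s≤s z≤n)) k+1<q)

    y-last<y₀ : b c ≡ b (suc c) → y (c + p) < y 0
    y-last<y₀ bc≡bc+1 = subst (y (c + p) <_) (y-periodic (mod-trans (mod-reflexive c+1+p≡q) (+q-mod 0)))
      (tail-mono bc≡bc+1 (y-< (ℕ.n<1+n c) c+1<q))

    jump : b c < b (suc c)
    jump with ℕ.m≤n⇒m<n∨m≡n (monotone-suc b-mono c c+1<q)
    ... | inj₁ bc<bc+1 = bc<bc+1
    ... | inj₂ bc≡bc+1 = ⊥-elim (ℕ.<-asym (y-< (ℕ.≤-trans 1≤p (ℕ.m≤n+m p c)) c+p<q) (y-last<y₀ bc≡bc+1))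

  module _ (b-mono : MonotoneBelow q b) (jump : b c < b (suc c)) where

    b-≤ : ∀ {i j} → i ≤ j → j < q → b i ≤ b j
    b-≤ {j = zero}  z≤n _ = ℕ.≤-refl
    b-≤ {i} {suc j} i≤1+j 1+j<q with ℕ.m≤n⇒m<n∨m≡n i≤1+j
    ... | inj₂ refl  = ℕ.≤-refl
    ... | inj₁ i<1+j = ℕ.≤-trans (b-≤ (ℕ.s≤s⁻¹ i<1+j) (ℕ.<-trans (ℕ.n<1+n j) 1+j<q)) (monotone-suc b-mono j 1+j<q)

    i+p<j+p : ∀ {i j} → i < j → i + p < j + p
    i+p<j+p = ℕ.+-monoˡ-< p

    straddle : ∀ {i j} → i ≤ c → c < j → j < q → b i < b j
    straddle i≤c c<j j<q = ℕ.≤-<-trans (b-≤ i≤c (ℕ.<-trans (ℕ.n<1+n c) c+1<q)) (ℕ.<-≤-trans jump (b-≤ c<j j<q))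

    shift-< : ∀ {i j} → i < j → j < q → b i ≡ b j → (i + p) % q < (j + p) % q
    shift-< {i} {j} i<j j<q bᵢ≡bⱼ with j ℕ.≤? c
    ... | yes j≤c = subst₂ _<_ (sym (ℕ.m<n⇒m%n≡m (ℕ.<-trans (i+p<j+p i<j) j+p<q))) (sym (ℕ.m<n⇒m%n≡m j+p<q)) (i+p<j+p i<j)
      where
      j+p<q : j + p < q
      j+p<q = ℕ.≤-<-trans (ℕ.+-monoˡ-≤ p j≤c) c+p<q
    ... | no j≰c with i ℕ.≤? c
    ...   | yes i≤c = ⊥-elim (ℕ.<-irrefl bᵢ≡bⱼ (straddle i≤c (ℕ.≰⇒> j≰c) j<q))
    ...   | no i≰c = subst₂ _<_ (sym (%-wrap q≤i+p (<q+q (ℕ.<-trans i<j j<q)))) (sym (%-wrap q≤j+p (<q+q j<q)))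
                       (ℕ.∸-monoˡ-< (i+p<j+p i<j) q≤i+p)
      where
      q≤i+p : q ≤ i + p
      q≤i+p = subst (_≤ i + p) c+1+p≡q (ℕ.+-monoˡ-≤ p (ℕ.≰⇒> i≰c))
      q≤j+p : q ≤ j + p
      q≤j+p = ℕ.≤-trans q≤i+p (ℕ.<⇒≤ (i+p<j+p i<j))
      <q+q : ∀ {k} → k < q → k + p < q + q
      <q+q k<q = ℕ.+-mono-< k<q p<q

    -- Induction on the number m of steps i ↦ i + p that take i to the ascent at c.
    increasing-from : ∀ m {i j} → i + m * p ≡ c [mod q ] → i < j → j < q → y i < y j
    increasing-from m {i} {j} _ i<j j<q with ℕ.m≤n⇒m<n∨m≡n (b-≤ (ℕ.<⇒≤ i<j) j<q)
    ... | inj₁ bᵢ<bⱼ = <-by-leading-digit bᵢ<bⱼ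
    increasing-from zero {i} {j} i+0≡c i<j j<q | inj₂ bᵢ≡bⱼ =
      ⊥-elim (ℕ.<-irrefl bᵢ≡bⱼ (straddle (ℕ.≤-reflexive i≡c) (subst (_< j) i≡c i<j) j<q))
      where
      i≡c : i ≡ c
      i≡c = mod⇒≡ (ℕ.<-trans i<j j<q) (ℕ.<-trans (ℕ.n<1+n c) c+1<q) (mod-trans (mod-reflexive (sym (ℕ.+-identityʳ i))) i+0≡c)
    increasing-from (suc m) {i} {j} i+[1+m]p≡c i<j j<q | inj₂ bᵢ≡bⱼ =
      <-by-tail bᵢ≡bⱼ (subst₂ _<_ (y-periodic (%-mod (i + p))) (y-periodic (%-mod (j + p)))
        (increasing-from m shifted-reach (shift-< i<j j<q bᵢ≡bⱼ) (ℕ.m%n<n (j + p) q)))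
      where
      shifted-reach : (i + p) % q + m * p ≡ c [mod q ]
      shifted-reach = begin
        (i + p) % q + m * p   ≈⟨ +-mod (%-mod (i + p)) (mod-refl {m * p}) ⟩
        i + p + m * p         ≡⟨ ℕ.+-assoc i p (m * p) ⟩
        i + suc m * p         ≈⟨ i+[1+m]p≡c ⟩
        c                     ∎
        where open mod-Reasoning

    digits⇒increasing : IncreasingBelow _<_ q y
    digits⇒increasing i<j j<q with reach c (ℕ.<-trans i<j j<q)
    ... | m , i+mp≡c = increasing-from m i+mp≡c i<j j<q

  increasing⇔digits : IncreasingBelow _<_ q y ⇔ (MonotoneBelow q b × b c < b (suc c))
  increasing⇔digits = mk⇔ increasing⇒digits (λ (b-mono , jump) → digits⇒increasing b-mono jump)

increasing-/ : ∀ q M .{{_ : NonZero M}} (x : ℕ → ℚ) (f : ℕ → ℕ) → (∀ j → x j ≡ + f j ℚ./ M) →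
  IncreasingBelow ℚ._<_ q x ⇔ IncreasingBelow _<_ q f
increasing-/ q M x f x≡f/M = mk⇔
  (λ x-< {i} {j} i<j j<q → /-cancelˡ-< M (subst₂ ℚ._<_ (x≡f/M i) (x≡f/M j) (x-< i<j j<q)))
  (λ f-< {i} {j} i<j j<q → subst₂ ℚ._<_ (sym (x≡f/M i)) (sym (x≡f/M j)) (/-monoˡ-< M (f-< i<j j<q)))

module PeriodicPoint (d n : ℕ) (a : Fin (suc n) → ℕ) (a<d : ∀ i → a i < d)
  (M : ℕ) .{{_ : NonZero M}} (d^q≡1+M : d ^ suc n ≡ suc M) where

  private
    q : ℕ
    q = suc n

    t : ℚ
    t = periodicPoint d q a

  open Modular q
  open RotatedDigits d n a
  private module Mod-M = Modular M

  rotation-recurrence : ∀ k → d * rotation k ≡ digit k * M + rotation (suc k)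
  rotation-recurrence k = ℕ.+-cancelʳ-≡ (digit k) _ _ (begin
    d * rotation k + digit k              ≡⟨ rotation-step k ⟩
    digit k * d ^ q + rotation (suc k)    ≡⟨ cong (λ x → digit k * x + rotation (suc k)) d^q≡1+M ⟩
    digit k * suc M + rotation (suc k)
      ≡⟨ solve 3 (λ x m r → x :* (con 1 :+ m) :+ r := x :* m :+ r :+ x) refl (digit k) M (rotation (suc k)) ⟩
    digit k * M + rotation (suc k) + digit k
      ∎)
    where
    open ≡-Reasoning
    open ℕ-Solver.+-*-Solver

  rotation-≤ : ∀ k → rotation k ≤ M
  rotation-≤ k = ℕ.s≤s⁻¹ (subst (rotation k <_) d^q≡1+M (rotation-< a<d k))

  d*[rotation%M]≡next : ∀ k → d * (rotation k % M) ≡ rotation (suc k) [mod M ]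
  d*[rotation%M]≡next k = begin
    d * (rotation k % M)              ≈⟨ Mod-M.*-mod (Mod-M.mod-refl {d}) (Mod-M.%-mod (rotation k)) ⟩
    d * rotation k                    ≡⟨ trans (rotation-recurrence k) (ℕ.+-comm (digit k * M) (rotation (suc k))) ⟩
    rotation (suc k) + digit k * M    ≈⟨ mk-mod (ℕ.[m+kn]%n≡m%n (rotation (suc k)) (digit k) M) ⟩
    rotation (suc k)                  ∎
    where open Mod-M.mod-Reasoning

  -- The remainder matters only when every digit is d - 1: then rotation k ≡ M but t = 0.
  orbit : ∀ k → σ^ d k t ≡ + (rotation k % M) ℚ./ M
  orbit zero    = begin
    frac (div (+ digitsValue d q a) (d ^ q ∸ 1))  ≡⟨ cong (λ m → frac (div (+ digitsValue d q a) (m ∸ 1))) d^q≡1+M ⟩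
    frac (div (+ digitsValue d q a) M)            ≡⟨ cong frac (div≡/ (+ digitsValue d q a) M) ⟩
    frac (+ digitsValue d q a ℚ./ M)              ≡⟨ frac-/ (digitsValue d q a) M ⟩
    + (digitsValue d q a % M) ℚ./ M               ≡⟨ cong (λ r → + (r % M) ℚ./ M) rotation-zero ⟩
    + (rotation 0 % M) ℚ./ M                      ∎
    where open ≡-Reasoning
  orbit (suc k) = begin
    σ d (σ^ d k t)                           ≡⟨ cong (σ d) (orbit k) ⟩
    σ d (+ (rotation k % M) ℚ./ M)           ≡⟨ σ-/ d (rotation k % M) M ⟩
    + (d * (rotation k % M) % M) ℚ./ M       ≡⟨ cong (λ r → + r ℚ./ M) (%≡% (d*[rotation%M]≡next k)) ⟩
    + (rotation (suc k) % M) ℚ./ M           ∎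
    where open ≡-Reasoning

  orbit-periodic : ∀ k k′ → k ≡ k′ [mod q ] → σ^ d k t ≡ σ^ d k′ t
  orbit-periodic k k′ k≡k′ =
    trans (orbit k) (trans (cong (λ r → + (r % M) ℚ./ M) (rotation-periodic k≡k′)) (sym (orbit k′)))

  saturated-step : ∀ k → rotation k ≡ M → rotation (suc k) ≡ M × suc (digit k) ≡ d
  saturated-step k rₖ≡M with ℕ.m≤n⇒m<n∨m≡n (rotation-≤ (suc k))
  ... | inj₁ rₖ₊₁<M = ⊥-elim (ℕ.<-irrefl refl (begin-strict
    d * M                            ≡⟨ cong (d *_) rₖ≡M ⟨
    d * rotation k                   ≡⟨ rotation-recurrence k ⟩
    digit k * M + rotation (suc k)   <⟨ ℕ.+-monoʳ-< (digit k * M) rₖ₊₁<M ⟩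
    digit k * M + M                  ≡⟨ ℕ.+-comm (digit k * M) M ⟩
    suc (digit k) * M                ≤⟨ ℕ.*-monoˡ-≤ M (a<d _) ⟩
    d * M                            ∎))
    where open ℕ.≤-Reasoning
  ... | inj₂ rₖ₊₁≡M = rₖ₊₁≡M , ℕ.*-cancelʳ-≡ (suc (digit k)) d M (begin
    suc (digit k) * M                ≡⟨ ℕ.+-comm M (digit k * M) ⟩
    digit k * M + M                  ≡⟨ cong (_+_ (digit k * M)) rₖ₊₁≡M ⟨
    digit k * M + rotation (suc k)   ≡⟨ rotation-recurrence k ⟨
    d * rotation k                   ≡⟨ cong (d *_) rₖ≡M ⟩
    d * M                            ∎)
    where open ≡-Reasoning

  saturated-from : ∀ {k} → rotation k ≡ M → ∀ m → rotation (m + k) ≡ M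
  saturated-from rₖ≡M zero    = rₖ≡M
  saturated-from rₖ≡M (suc m) = proj₁ (saturated-step _ (saturated-from rₖ≡M m))

  unsaturated-or-saturated : (∀ k → rotation k < M) ⊎ (∀ k → rotation k ≡ M)
  unsaturated-or-saturated with ℕ.m≤n⇒m<n∨m≡n (rotation-≤ 0)
  ... | inj₂ r₀≡M = inj₂ (λ k → subst (λ j → rotation j ≡ M) (ℕ.+-identityʳ k) (saturated-from r₀≡M k))
  ... | inj₁ r₀<M = inj₁ unsaturated
    where
    unsaturated : ∀ k → rotation k < M
    unsaturated k with ℕ.m≤n⇒m<n∨m≡n (rotation-≤ k)
    ... | inj₁ rₖ<M = rₖ<M
    ... | inj₂ rₖ≡M = ⊥-elim (ℕ.<-irrefl (trans (rotation-periodic 0≡n*k+k) (saturated-from rₖ≡M (n * k))) r₀<M)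
      where
      0≡n*k+k : 0 ≡ n * k + k [mod q ]
      0≡n*k+k = mk-mod (sym (trans (cong (_% q) (solve 2 (λ n k → n :* k :+ k := k :* (con 1 :+ n)) refl n k)) (ℕ.m*n%n≡0 k q)))
        where open ℕ-Solver.+-*-Solver

  module Ranked (p p⁻¹ c : ℕ) (p*p⁻¹≡1 : p * p⁻¹ ≡ 1 [mod q ]) (1≤p : 1 ≤ p) (c+1+p≡q : suc c + p ≡ q) where

    open Inverse p p⁻¹ p*p⁻¹≡1

    y : ℕ → ℕ
    y j = rotation (j * p⁻¹)

    b : ℕ → ℕ
    b j = digit (j * p⁻¹)

    y-step : ∀ i → d * y i ≡ b i * M + y (i + p)
    y-step i = trans (rotation-recurrence (i * p⁻¹)) (cong (_+_ (b i * M)) (rotation-periodic (1+i*p⁻¹≡[i+p]*p⁻¹ i)))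

    y-periodic : ∀ {i j} → i ≡ j [mod q ] → y i ≡ y j
    y-periodic i≡j = rotation-periodic (*-mod i≡j (mod-refl {p⁻¹}))

    1<q : 1 < q
    1<q = ℕ.<-≤-trans (s≤s 1≤p) (subst (suc p ≤_) c+1+p≡q (s≤s (ℕ.m≤n+m p c)))

    increasing⇔digits : IncreasingBelow ℚ._<_ q (ranked d p⁻¹ t) ⇔ (MonotoneBelow q b × b c < b (suc c))
    increasing⇔digits with unsaturated-or-saturated
    ... | inj₁ r<M = Equivalence.trans (increasing-/ q M (ranked d p⁻¹ t) y ranked≡y/M)
                       (Lexicographic.increasing⇔digits d M q p p⁻¹ c {{d≢0}} p*p⁻¹≡1 1≤p c+1+p≡q
                         y b (λ i → r<M _) y-periodic y-step)
      where
      d≢0 : NonZero d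
      d≢0 = ℕ.>-nonZero (ℕ.≤-<-trans z≤n (a<d Fin.zero))
      ranked≡y/M : ∀ j → ranked d p⁻¹ t j ≡ + y j ℚ./ M
      ranked≡y/M j = trans (orbit (j * p⁻¹)) (cong (λ r → + r ℚ./ M) (ℕ.m<n⇒m%n≡m (r<M _)))
    ... | inj₂ r≡M = mk⇔ (λ ranked-< → ⊥-elim (ℚ.<-irrefl (ranked-equal 0 1) (ranked-< (s≤s z≤n) 1<q)))
                         (λ (_ , jump) → ⊥-elim (ℕ.<-irrefl (b-equal c (suc c)) jump))
      where
      ranked-equal : ∀ i j → ranked d p⁻¹ t i ≡ ranked d p⁻¹ t j
      ranked-equal i j = trans (orbit (i * p⁻¹))
        (trans (cong (λ r → + (r % M) ℚ./ M) (trans (r≡M _) (sym (r≡M _)))) (sym (orbit (j * p⁻¹))))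
      b-equal : ∀ i j → b i ≡ b j
      b-equal i j = ℕ.suc-injective
        (trans (proj₂ (saturated-step (i * p⁻¹) (r≡M _))) (sym (proj₂ (saturated-step (j * p⁻¹) (r≡M _)))))

corollary3p2 : (d q p pstar : ℕ) → .{{_ : NonZero q}} → (a : Fin q → ℕ) →
    2 ≤ d → 2 ≤ q → 1 ≤ p → p < q → gcd p q ≡ 1 → (p * pstar) % q ≡ 1 →
    ((i : Fin q) → a i < d) →
    ((Rotational d (InOrbit d (periodicPoint d q a)) p q ×
      ((x : ℚ) → InOrbit d (periodicPoint d q a) x → periodicPoint d q a ℚ.≤ x))
     ⇔
     (((k : ℕ) → k + 1 < q → a ((k * pstar) mod q) ≤ a (((k + 1) * pstar) mod q)) ×
      a (((q ∸ p ∸ 1) * pstar) mod q) < a (((q ∸ p) * pstar) mod q)))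
corollary3p2 d q@(suc n) p p⁻¹ a 2≤d _ 1≤p p<q _ p*p⁻¹%q≡1 a<d =
  subst (λ j → (Rotational d (InOrbit d t) p q × Minimal) ⇔ (MonotoneBelow q b × b c < b j)) 1+c≡q∸p
    (Equivalence.trans rotational⇔increasing increasing⇔digits)
  where
  -- The hypothesis gcd p q ≡ 1 (ignored above) follows from p * p⁻¹ ≡ 1 (mod q).
  t : ℚ
  t = periodicPoint d q a

  M : ℕ
  M = d ^ q ∸ 1

  2≤d^q : 2 ≤ d ^ q
  2≤d^q = ℕ.≤-trans 2≤d (ℕ.m≤m*n d (d ^ n) {{ℕ.m^n≢0 d n {{ℕ.>-nonZero (ℕ.≤-trans (s≤s z≤n) 2≤d)}}}})

  instance
    M≢0 : NonZero M
    M≢0 = ℕ.>-nonZero (ℕ.m<n⇒0<n∸m 2≤d^q)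

  d^q≡1+M : d ^ q ≡ suc M
  d^q≡1+M = sym (ℕ.m+[n∸m]≡n (ℕ.≤-trans (s≤s z≤n) 2≤d^q))

  c : ℕ
  c = q ∸ p ∸ 1

  1+c≡q∸p : suc c ≡ q ∸ p
  1+c≡q∸p = trans (ℕ.+-comm 1 c) (ℕ.m∸n+n≡m (ℕ.m<n⇒0<n∸m p<q))

  1+c+p≡q : suc c + p ≡ q
  1+c+p≡q = trans (cong (_+ p) 1+c≡q∸p) (ℕ.m∸n+n≡m (ℕ.<⇒≤ p<q))

  p*p⁻¹≡1 : p * p⁻¹ ≡ 1 [mod q ]
  p*p⁻¹≡1 = Modular.%≡1⇒≡1[mod] q p*p⁻¹%q≡1

  open PeriodicPoint d n a a<d M d^q≡1+M
  open Ranked p p⁻¹ c p*p⁻¹≡1 1≤p 1+c+p≡q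
  open RotationalOrbit d n p p⁻¹ t 1≤p p<q p*p⁻¹≡1 orbit-periodic
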